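{- Let $\mathscr{A} = (Q,\Sigma,\delta)$ be an aperiodically $1$-contracting DFA with $n$ states, and let $W = \{w_1,\ldots,w_n\}\subseteq \Sigma^\star$ be a $1$-contracting collection for $\mathscr{A}$ for which the induced state map $\sigma_W$ is a cyclic permutation on $Q$. Then for every $k$ with $1\le k\le n$, every nonempty $k$-subset $S$ of $Q$ is reachable from $Q$ by a word $w_S$ of the form $w_S = w_{i_1}w_{i_2}\cdots w_{i_{n-k}}$ (a concatenation of $n-k$ words from $W$, with $i_1,\ldots,i_{n-k}\in\{1,\ldots,n\}$), i.e. $\delta(Q,w_S)=S$.
   Context: A DFA is $\mathscr{A}=(Q,\Sigma,\delta)$ with finite state set $Q$, finite alphabet $\Sigma$ and transition function $\delta:Q\times\Sigma\to Q$, extended to $Q\times\Sigma^\star$ in the usual way ($\delta(q,\varepsilon)=q$, $\delta(q,wa)=\delta(\delta(q,w),a)$), and to subsets by $\delta(S,w)=\{\delta(q,w)\mid q\in S\}$. A set $S\subseteq Q$ is reachable (from $Q$) by $w$ if $\delta(Q,w)=S$. For $q\in Q$ and $w\in\Sigma^\star$, $\delta^{ -1}(q,w)=\{p\in Q\mid \delta(p,w)=q\}$. A word $w$ is a $1$-deficient word that excludes $q$ if $\delta(Q,w)=Q\setminus\{q\}$; such a word then has exactly one state $q^c$ with $|\delta^{ -1}(q^c,w)|=2$, called its contracting state. A collection $W\subseteq\Sigma^\star$ is a $1$-contracting collection for $\mathscr{A}$ if for every $q\in Q$ it contains exactly one $1$-deficient word excluding $q$; $\mathscr{A}$ is $1$-contracting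 if such a collection exists. The state map induced by $W$ is $\sigma_W:Q\to Q$, where $\sigma_W(q)$ is the contracting state of the unique word in $W$ excluding $q$. $\mathscr{A}$ is aperiodically $1$-contracting if there is a $1$-contracting collection $W$ for which $\sigma_W$ is a cyclic permutation of $Q$ (i.e. $\sigma_W^n(q)=q$ and $\sigma_W^k(q)\ne q$ for $1\le k<n$, where $n=|Q|$). -}

module Defs where

open import Data.Nat using (ℕ; zero; suc)
open import Data.Fin using (Fin; _≟_)
open import Data.Fin.Subset using (Subset; _∈_; ∣_∣)
open import Data.List using (List; foldl)
open import Data.Vec using (tabulate)
open import Data.Product using (∃; Σ; _×_)
open import Relation.Nullary using (¬_)
open import Relation.Nullary.Decidable using (⌊_⌋)
open import Relation.Binary.PropositionalEquality using (_≡_; _≢_)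
open import Function.Bundles using (_⇔_)

record DFA (n m : ℕ) : Set where
  field
    δ : Fin n → Fin m → Fin n

Word : ℕ → Set
Word m = List (Fin m)

module _ {n m : ℕ} (A : DFA n m) where
  open DFA A

  δ* : Fin n → Word m → Fin n
  δ* q w = foldl δ q w

  ReachableBy : Subset n → Word m → Set
  ReachableBy S w = ∀ q → (q ∈ S) ⇔ (∃ λ p → δ* p w ≡ q)

  ExcludesOne : Word m → Fin n → Set
  ExcludesOne w q = ∀ r → (∃ λ p → δ* p w ≡ r) ⇔ (r ≢ q)

  preimage : Fin n → Word m → Subset n
  preimage q w = tabulate (λ p → ⌊ δ* p w ≟ q ⌋)

  IsContractingState : Word m → Fin n → Set
  IsContractingState w c = ∣ preimage c w ∣ ≡ 2

  -- W indexed by excluded state: W q is the (unique) 1-deficient word of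
  -- the collection excluding q.
  IsOneContractingCollection : (Fin n → Word m) → Set
  IsOneContractingCollection W = ∀ q → ExcludesOne (W q) q

  IsInducedStateMap : (Fin n → Word m) → (Fin n → Fin n) → Set
  IsInducedStateMap W σ = ∀ q → IsContractingState (W q) (σ q)

iter : {A : Set} → (A → A) → ℕ → A → A
iter f zero x = x
iter f (suc k) x = f (iter f k x)

open import Data.Nat using (_≤_; _<_)

IsCyclic : {n : ℕ} → (Fin n → Fin n) → Set
IsCyclic {n} σ = ∀ q → (iter σ n q ≡ q) × (∀ k → 1 ≤ k → k < n → iter σ k q ≢ q)

module Submission where

--  * If |S| = n then S = Q is reached by the empty word.
--  * Otherwise there is a state outside S and one inside S.  Since σ is
--    cyclic, the σ-orbit of the former passes through the latter, so
--    somewhere it leaves the complement: there is q ∉ S with σ q ∈ S.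
--  * Let f = δ(·, W q).  The image of f is Q ∖ {q}, so counting
--    preimages shows that f has fibre sizes 0 over q, 2 over σ q and 1
--    elsewhere.  Hence T = f⁻¹(S) has |T| = |S| + 1, and a word u with
--    δ(Q,u) = T gives δ(Q, u · W q) = S (S ⊆ image of f as q ∉ S).

open import Defs
open import Data.Nat using (ℕ; zero; suc; _+_; _*_; _∸_; _≤_; _<_; z≤n)
open import Data.Nat.Properties
  using (+-*-semiring; +-mono-≤; +-monoʳ-≤; +-cancelʳ-≤; +-cancelˡ-≡; ≤-antisym; ≤-reflexive;
         ≤-trans; ≤-<-trans; m≤m+n; m≤n+m; m<m+n; *-identityˡ; *-identityʳ; *-distribʳ-+;
         +-assoc; +-identityʳ; m+[n∸m]≡n; m∸n≤m; <⇒≢; m<n⇒0<n∸m; <⇒≤; n<1+n; 0<1+n)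
open import Data.Bool using (Bool; true; false)
open import Data.Fin using (Fin; zero; suc; _≟_; toℕ; punchOut)
open import Data.Fin.Properties
  using (suc-injective; any?; pigeonhole; punchOut-injective; toℕ<n)
open import Data.Fin.Subset using (Subset; _∈_; _∉_; ∣_∣; ∁; Nonempty)
open import Data.Fin.Subset.Properties
  using (∈⊤; ∣p∣≡n⇒p≡⊤; Empty-unique; ∣⊥∣≡0; nonempty?; ∣∁p∣≡n∸∣p∣; x∈∁p⇒x∉p; _∈?_)
open import Data.Vec using (Vec; []; _∷_; lookup; tabulate; toList; _∷ʳ_)
open import Data.Vec.Properties using (toList-∷ʳ; lookup⇒[]=; []=⇒lookup; lookup∘tabulate)
open import Data.List as List using (List; concatMap; _++_)
open import Data.List.Properties using (foldl-++; ++-identityʳ; concatMap-++)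
open import Data.Product using (∃; _×_; _,_; proj₁; proj₂)
open import Data.Empty using (⊥-elim)
open import Relation.Nullary using (¬_; yes; no; contradiction)
open import Relation.Nullary.Decidable using (⌊_⌋; ⌊⌋-map′)
open import Relation.Unary using (Decidable)
open import Relation.Binary.PropositionalEquality
  using (_≡_; _≢_; refl; sym; trans; cong; cong₂; subst; module ≡-Reasoning)
open import Function.Bundles using (_⇔_; mk⇔; Equivalence)
open import Algebra.Properties.Semiring.Sum +-*-semiring
  using (sum; sum-syntax; sum-replicate-zero; ∑-distrib-+; ∑-comm; *-distribʳ-sum; sum-cong-≗)

ind : Bool → ℕ
ind true  = 1
ind false = 0

eqInd : ∀ {n} → Fin n → Fin n → ℕ
eqInd x y = ind ⌊ x ≟ y ⌋

eqInd-refl : ∀ {n} (x : Fin n) → eqInd x x ≡ 1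
eqInd-refl x with x ≟ x
... | yes _  = refl
... | no x≢x = contradiction refl x≢x

∑-const-1 : ∀ n → ∑[ i < n ] 1 ≡ n
∑-const-1 zero    = refl
∑-const-1 (suc n) = cong suc (∑-const-1 n)

∑-mono : ∀ {n} {f g : Fin n → ℕ} → (∀ i → f i ≤ g i) → sum f ≤ sum g
∑-mono {zero}  f≤g = z≤n
∑-mono {suc n} f≤g = +-mono-≤ (f≤g zero) (∑-mono (λ i → f≤g (suc i)))

∑-term : ∀ {n} (f : Fin n → ℕ) i → f i ≤ sum f
∑-term f zero    = m≤m+n (f zero) _
∑-term f (suc i) = ≤-trans (∑-term (λ j → f (suc j)) i) (m≤n+m _ (f zero))

∑-≤-≡⇒≡ : ∀ {n} {f g : Fin n → ℕ} → (∀ i → f i ≤ g i) → sum f ≡ sum g → ∀ i → f i ≡ g i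
∑-≤-≡⇒≡ {suc n} {f} {g} f≤g ∑f≡∑g = pointwise
  where
  F G : ℕ
  F = sum (λ i → f (suc i))
  G = sum (λ i → g (suc i))
  -- g₀ + F ≤ g₀ + G = f₀ + F, so g₀ ≤ f₀.
  head≡ : f zero ≡ g zero
  head≡ = ≤-antisym (f≤g zero) (+-cancelʳ-≤ F (g zero) (f zero)
    (≤-trans (+-monoʳ-≤ (g zero) (∑-mono (λ i → f≤g (suc i)))) (≤-reflexive (sym ∑f≡∑g))))
  tail≡ : F ≡ G
  tail≡ = +-cancelˡ-≡ (f zero) F G (trans ∑f≡∑g (cong (_+ G) (sym head≡)))
  pointwise : ∀ i → f i ≡ g i
  pointwise zero    = head≡
  pointwise (suc i) = ∑-≤-≡⇒≡ (λ j → f≤g (suc j)) tail≡ i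

∑-eqInd : ∀ {n} (x : Fin n) (h : Fin n → ℕ) → ∑[ r < n ] (eqInd x r * h r) ≡ h x
∑-eqInd {suc n} zero h =
  trans (cong₂ _+_ (+-identityʳ (h zero)) (sum-replicate-zero n)) (+-identityʳ (h zero))
∑-eqInd {suc n} (suc x) h = trans (sum-cong-≗ shift) (∑-eqInd x (λ r → h (suc r)))
  where
  shift : ∀ r → eqInd (suc x) (suc r) * h (suc r) ≡ eqInd x r * h (suc r)
  shift r = cong (λ b → ind b * h (suc r)) (⌊⌋-map′ (cong suc) suc-injective (x ≟ r))

χ : ∀ {n} → Subset n → Fin n → ℕ
χ S r = ind (lookup S r)

∣∣-as-∑ : ∀ {n} (S : Subset n) → ∣ S ∣ ≡ sum (χ S)
∣∣-as-∑ []          = refl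
∣∣-as-∑ (true ∷ S)  = cong suc (∣∣-as-∑ S)
∣∣-as-∑ (false ∷ S) = ∣∣-as-∑ S

∣tabulate∣ : ∀ {n} (b : Fin n → Bool) → ∣ tabulate b ∣ ≡ ∑[ r < n ] ind (b r)
∣tabulate∣ b =
  trans (∣∣-as-∑ (tabulate b)) (sum-cong-≗ (λ r → cong ind (lookup∘tabulate b r)))

∈⇒χ≡1 : ∀ {n} {S : Subset n} {x} → x ∈ S → χ S x ≡ 1
∈⇒χ≡1 x∈S = cong ind ([]=⇒lookup x∈S)

∉⇒lookup≡false : ∀ {n} {S : Subset n} {x} → x ∉ S → lookup S x ≡ false
∉⇒lookup≡false {S = S} {x} x∉S with lookup S x in eq
... | true  = contradiction (lookup⇒[]= x S eq) x∉S
... | false = refl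

∉⇒χ≡0 : ∀ {n} {S : Subset n} {x} → x ∉ S → χ S x ≡ 0
∉⇒χ≡0 x∉S = cong ind (∉⇒lookup≡false x∉S)

∣∣≡n⇒∈ : ∀ {n} (S : Subset n) → ∣ S ∣ ≡ n → ∀ x → x ∈ S
∣∣≡n⇒∈ S ∣S∣≡n x = subst (x ∈_) (sym (∣p∣≡n⇒p≡⊤ ∣S∣≡n)) ∈⊤

1≤∣∣⇒nonempty : ∀ {n} (S : Subset n) → 1 ≤ ∣ S ∣ → Nonempty S
1≤∣∣⇒nonempty {n} S 1≤∣S∣ with nonempty? S
... | yes nonempty = nonempty
... | no empty     = ⊥-elim (<⇒≢ 1≤∣S∣ (sym ∣S∣≡0))
  where
  ∣S∣≡0 : ∣ S ∣ ≡ 0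
  ∣S∣≡0 = trans (cong ∣_∣ (Empty-unique empty)) (∣⊥∣≡0 n)

∣∣<n⇒∉ : ∀ {n} (S : Subset n) → ∣ S ∣ < n → ∃ λ x → x ∉ S
∣∣<n⇒∉ {n} S ∣S∣<n
  with 1≤∣∣⇒nonempty (∁ S) (subst (1 ≤_) (sym (∣∁p∣≡n∸∣p∣ S)) (m<n⇒0<n∸m ∣S∣<n))
... | x , x∈∁S = x , x∈∁p⇒x∉p x∈∁S

fibreSize : ∀ {n m} → (Fin n → Fin m) → Fin m → ℕ
fibreSize {n} f r = ∑[ p < n ] eqInd (f p) r

∑-fibres : ∀ {n m} (f : Fin n → Fin m) (h : Fin m → ℕ) →
  ∑[ p < n ] h (f p) ≡ ∑[ r < m ] (fibreSize f r * h r)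
∑-fibres {n} {m} f h = begin
  ∑[ p < n ] h (f p)
    ≡⟨ sum-cong-≗ (λ p → sym (∑-eqInd (f p) h)) ⟩
  ∑[ p < n ] ∑[ r < m ] (eqInd (f p) r * h r)
    ≡⟨ ∑-comm (λ p r → eqInd (f p) r * h r) ⟩
  ∑[ r < m ] ∑[ p < n ] (eqInd (f p) r * h r)
    ≡⟨ sum-cong-≗ (λ r → sym (*-distribʳ-sum (h r) (λ p → eqInd (f p) r))) ⟩
  ∑[ r < m ] (fibreSize f r * h r)
    ∎
  where open ≡-Reasoning

∑-fibreSize : ∀ {n m} (f : Fin n → Fin m) → ∑[ r < m ] fibreSize f r ≡ n
∑-fibreSize {n} {m} f = begin
  ∑[ r < m ] fibreSize f r        ≡⟨ sum-cong-≗ (λ r → sym (*-identityʳ (fibreSize f r))) ⟩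
  ∑[ r < m ] (fibreSize f r * 1)  ≡⟨ sym (∑-fibres f (λ _ → 1)) ⟩
  ∑[ p < n ] 1                    ≡⟨ ∑-const-1 n ⟩
  n                               ∎
  where open ≡-Reasoning

∑-eqInd-1 : ∀ {n} (x : Fin n) → ∑[ r < n ] eqInd x r ≡ 1
∑-eqInd-1 x = trans (sum-cong-≗ (λ r → sym (*-identityʳ (eqInd x r)))) (∑-eqInd x (λ _ → 1))

-- A map of Fin n into itself missing exactly q in its image and with a
-- fibre of size 2 over c has fibre sizes 0 over q, 2 over c and 1
-- elsewhere; uniformly, fibreSize r + [q = r] = 1 + [c = r].  Each side
-- sums to n + 1 and the right one is a pointwise lower bound.
fibre-profile : ∀ {n} (f : Fin n → Fin n) (q c : Fin n) →
  (∀ r → r ≢ q → ∃ λ p → f p ≡ r) → fibreSize f c ≡ 2 →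
  ∀ r → fibreSize f r + eqInd q r ≡ 1 + eqInd c r
fibre-profile {n} f q c covers ∣f⁻¹c∣≡2 r = sym (∑-≤-≡⇒≡ lower (trans ∑rhs (sym ∑lhs)) r)
  where
  lower : ∀ r → 1 + eqInd c r ≤ fibreSize f r + eqInd q r
  lower r with c ≟ r
  ... | yes refl = ≤-trans (≤-reflexive (sym ∣f⁻¹c∣≡2)) (m≤m+n _ _)
  ... | no _ with q ≟ r
  ...   | yes refl = m≤n+m 1 _
  ...   | no q≢r with covers r (λ r≡q → q≢r (sym r≡q))
  ...     | p , fp≡r = ≤-trans (≤-trans (≤-reflexive 1≡[fp≡r]) (∑-term (λ p → eqInd (f p) r) p))
                                 (m≤m+n _ 0)
    where
    1≡[fp≡r] : 1 ≡ eqInd (f p) r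
    1≡[fp≡r] = sym (trans (cong (λ y → eqInd y r) fp≡r) (eqInd-refl r))
  ∑lhs : ∑[ r < n ] (fibreSize f r + eqInd q r) ≡ n + 1
  ∑lhs = trans (∑-distrib-+ (fibreSize f) (eqInd q)) (cong₂ _+_ (∑-fibreSize f) (∑-eqInd-1 q))
  ∑rhs : ∑[ r < n ] (1 + eqInd c r) ≡ n + 1
  ∑rhs = trans (∑-distrib-+ (λ _ → 1) (eqInd c)) (cong₂ _+_ (∑-const-1 n) (∑-eqInd-1 c))

_⁻¹[_] : ∀ {n m} → (Fin n → Fin m) → Subset m → Subset n
f ⁻¹[ S ] = tabulate (λ p → lookup S (f p))

∈-⁻¹ : ∀ {n m} (f : Fin n → Fin m) (S : Subset m) p → p ∈ f ⁻¹[ S ] ⇔ f p ∈ S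
∈-⁻¹ f S p = mk⇔
  (λ p∈f⁻¹S → lookup⇒[]= (f p) S (trans (sym (lookup∘tabulate _ p)) ([]=⇒lookup p∈f⁻¹S)))
  (λ fp∈S → lookup⇒[]= p (f ⁻¹[ S ]) (trans (lookup∘tabulate _ p) ([]=⇒lookup fp∈S)))

∣⁻¹∣ : ∀ {n} (f : Fin n → Fin n) (q c : Fin n) →
  (∀ r → r ≢ q → ∃ λ p → f p ≡ r) → fibreSize f c ≡ 2 →
  ∀ S → ∣ f ⁻¹[ S ] ∣ + χ S q ≡ ∣ S ∣ + χ S c
∣⁻¹∣ {n} f q c covers ∣f⁻¹c∣≡2 S = begin
  ∣ f ⁻¹[ S ] ∣ + χ S q
    ≡⟨ cong₂ _+_ (∣tabulate∣ (λ p → lookup S (f p))) (sym (∑-eqInd q (χ S))) ⟩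
  ∑[ p < n ] χ S (f p) + ∑[ r < n ] (eqInd q r * χ S r)
    ≡⟨ cong (_+ _) (∑-fibres f (χ S)) ⟩
  ∑[ r < n ] (fibreSize f r * χ S r) + ∑[ r < n ] (eqInd q r * χ S r)
    ≡⟨ sym (∑-distrib-+ {n} _ _) ⟩
  ∑[ r < n ] (fibreSize f r * χ S r + eqInd q r * χ S r)
    ≡⟨ sum-cong-≗ (λ r → sym (*-distribʳ-+ (χ S r) (fibreSize f r) (eqInd q r))) ⟩
  ∑[ r < n ] ((fibreSize f r + eqInd q r) * χ S r)
    ≡⟨ sum-cong-≗ (λ r → cong (_* χ S r) (fibre-profile f q c covers ∣f⁻¹c∣≡2 r)) ⟩
  ∑[ r < n ] ((1 + eqInd c r) * χ S r)
    ≡⟨ sum-cong-≗ (λ r → *-distribʳ-+ (χ S r) 1 (eqInd c r)) ⟩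
  ∑[ r < n ] (1 * χ S r + eqInd c r * χ S r)
    ≡⟨ ∑-distrib-+ {n} _ _ ⟩
  ∑[ r < n ] (1 * χ S r) + ∑[ r < n ] (eqInd c r * χ S r)
    ≡⟨ cong₂ _+_ (sum-cong-≗ (λ r → *-identityˡ (χ S r))) (∑-eqInd c (χ S)) ⟩
  sum (χ S) + χ S c
    ≡⟨ cong (_+ χ S c) (sym (∣∣-as-∑ S)) ⟩
  ∣ S ∣ + χ S c
    ∎
  where open ≡-Reasoning

iter-+ : ∀ {A : Set} (f : A → A) i j x → iter f (i + j) x ≡ iter f i (iter f j x)
iter-+ f zero    j x = refl
iter-+ f (suc i) j x = cong f (iter-+ f i j x)

iter-shift : ∀ {A : Set} (f : A → A) i x → iter f i (f x) ≡ f (iter f i x)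
iter-shift f zero    x = refl
iter-shift f (suc i) x = cong f (iter-shift f i x)

iter-injective : ∀ {A : Set} (f : A → A) → (∀ {a b} → f a ≡ f b → a ≡ b) →
  ∀ i {a b} → iter f i a ≡ iter f i b → a ≡ b
iter-injective f f-inj zero    eq = eq
iter-injective f f-inj (suc i) eq = iter-injective f f-inj i (f-inj eq)

switch-point : ∀ {A : Set} {P : A → Set} → Decidable P → (f : A → A) →
  ∀ j x → ¬ P x → P (iter f j x) → ∃ λ q → ¬ P q × P (f q)
switch-point P? f zero    x ¬Px Px = contradiction Px ¬Px
switch-point P? f (suc j) x ¬Px Pfⱼ₊₁x with P? (iter f j x)
... | yes Pfʲx = switch-point P? f j x ¬Px Pfʲx
... | no ¬Pfʲx = iter f j x , ¬Pfʲx , Pfⱼ₊₁x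

-- A cyclic permutation is injective: σ ⁿ⁻¹ is a left inverse of σ.
cyclic-injective : ∀ {n} (σ : Fin n → Fin n) → IsCyclic σ → ∀ {a b} → σ a ≡ σ b → a ≡ b
cyclic-injective {suc k} σ cyclic {a} {b} σa≡σb = begin
  a                   ≡⟨ sym (proj₁ (cyclic a)) ⟩
  σ (iter σ k a)      ≡⟨ sym (iter-shift σ k a) ⟩
  iter σ k (σ a)      ≡⟨ cong (iter σ k) σa≡σb ⟩
  iter σ k (σ b)      ≡⟨ iter-shift σ k b ⟩
  σ (iter σ k b)      ≡⟨ proj₁ (cyclic b) ⟩
  b                   ∎
  where open ≡-Reasoning

orbit-distinct : ∀ {n} (σ : Fin n → Fin n) → IsCyclic σ → ∀ r {i j} → i < j → j < n →
  iter σ i r ≢ iter σ j r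
orbit-distinct σ cyclic r {i} {j} i<j j<n σⁱr≡σʲr =
  proj₂ (cyclic r) d (m<n⇒0<n∸m i<j) (≤-<-trans (m∸n≤m j i) j<n) (sym r≡σᵈr)
  where
  d = j ∸ i
  σⁱr≡σⁱσᵈr : iter σ i r ≡ iter σ i (iter σ d r)
  σⁱr≡σⁱσᵈr = begin
    iter σ i r              ≡⟨ σⁱr≡σʲr ⟩
    iter σ j r              ≡⟨ cong (λ k → iter σ k r) (sym (m+[n∸m]≡n (<⇒≤ i<j))) ⟩
    iter σ (i + d) r        ≡⟨ iter-+ σ i d r ⟩
    iter σ i (iter σ d r)   ∎
    where open ≡-Reasoning
  r≡σᵈr : r ≡ iter σ d r
  r≡σᵈr = iter-injective σ (cyclic-injective σ cyclic) i σⁱr≡σⁱσᵈr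

-- Every state lies on the orbit of every other: otherwise the n distinct
-- orbit points would fit into the n − 1 states other than s.
orbit-covers : ∀ {n} (σ : Fin n → Fin n) → IsCyclic σ → ∀ r s → ∃ λ j → iter σ j r ≡ s
orbit-covers {suc k} σ cyclic r s with any? (λ j → iter σ (toℕ j) r ≟ s)
... | yes (j , σʲr≡s) = toℕ j , σʲr≡s
... | no  misses with pigeonhole (n<1+n k) avoid-s
  where
  avoid-s : Fin (suc k) → Fin k
  avoid-s j = punchOut {i = s} (λ s≡σʲr → misses (j , sym s≡σʲr))
... | i , j , i<j , same = contradiction
  (punchOut-injective {i = s} (λ e → misses (i , sym e)) (λ e → misses (j , sym e)) same)
  (orbit-distinct σ cyclic r i<j (toℕ<n j))

exit-point : ∀ {n} (σ : Fin n → Fin n) → IsCyclic σ → (S : Subset n) →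
  ∀ {r s} → r ∉ S → s ∈ S → ∃ λ q → q ∉ S × σ q ∈ S
exit-point σ cyclic S {r} {s} r∉S s∈S with orbit-covers σ cyclic r s
... | j , σʲr≡s = switch-point (_∈? S) σ j r r∉S (subst (_∈ S) (sym σʲr≡s) s∈S)

module _ {n m : ℕ} (A : DFA n m) where

  reach-all : ∀ S → (∀ x → x ∈ S) → ReachableBy A S List.[]
  reach-all S all x = mk⇔ (λ _ → x , refl) (λ _ → all x)

  reach-++ : ∀ (u w : Word m) (S : Subset n) → (∀ x → x ∈ S → ∃ λ p → δ* A p w ≡ x) →
    ReachableBy A ((λ p → δ* A p w) ⁻¹[ S ]) u → ReachableBy A S (u ++ w)
  reach-++ u w S image reach x = mk⇔ reached inS
    where
    f : Fin n → Fin n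
    f p = δ* A p w
    split : ∀ p → δ* A p (u ++ w) ≡ f (δ* A p u)
    split p = foldl-++ (DFA.δ A) p u w
    reached : x ∈ S → ∃ λ p → δ* A p (u ++ w) ≡ x
    reached x∈S with image x x∈S
    ... | y , fy≡x
      with Equivalence.to (reach y) (Equivalence.from (∈-⁻¹ f S y) (subst (_∈ S) (sym fy≡x) x∈S))
    ... | p , δpu≡y = p , trans (split p) (trans (cong f δpu≡y) fy≡x)
    inS : (∃ λ p → δ* A p (u ++ w) ≡ x) → x ∈ S
    inS (p , δpuw≡x) = subst (_∈ S) (trans (sym (split p)) δpuw≡x)
      (Equivalence.to (∈-⁻¹ f S (δ* A p u)) (Equivalence.from (reach (δ* A p u)) (p , refl)))

concatMap-∷ʳ : ∀ {n m d} (W : Fin n → Word m) (is : Vec (Fin n) d) q →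
  concatMap W (toList (is ∷ʳ q)) ≡ concatMap W (toList is) ++ W q
concatMap-∷ʳ W is q = begin
  concatMap W (toList (is ∷ʳ q))
    ≡⟨ cong (concatMap W) (toList-∷ʳ q is) ⟩
  concatMap W (toList is ++ List.[ q ])
    ≡⟨ concatMap-++ W (toList is) List.[ q ] ⟩
  concatMap W (toList is) ++ (W q ++ List.[])
    ≡⟨ cong (concatMap W (toList is) ++_) (++-identityʳ (W q)) ⟩
  concatMap W (toList is) ++ W q
    ∎
  where open ≡-Reasoning

module _ {n m : ℕ} (A : DFA n m) (W : Fin n → Word m) (σ : Fin n → Fin n)
  (contracting : IsOneContractingCollection A W) (induced : IsInducedStateMap A W σ)
  (cyclic : IsCyclic σ) where

  W⁻¹ : Fin n → Subset n → Subset n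
  W⁻¹ q S = (λ p → δ* A p (W q)) ⁻¹[ S ]

  image-W : ∀ q r → r ≢ q → ∃ λ p → δ* A p (W q) ≡ r
  image-W q r = Equivalence.from (contracting q r)

  fibre-W : ∀ q → fibreSize (λ p → δ* A p (W q)) (σ q) ≡ 2
  fibre-W q = trans (sym (∣tabulate∣ (λ p → ⌊ δ* A p (W q) ≟ σ q ⌋))) (induced q)

  ∣W⁻¹∣ : ∀ q S → q ∉ S → σ q ∈ S → ∣ W⁻¹ q S ∣ ≡ ∣ S ∣ + 1
  ∣W⁻¹∣ q S q∉S σq∈S = begin
    ∣ W⁻¹ q S ∣                ≡⟨ sym (+-identityʳ ∣ W⁻¹ q S ∣) ⟩
    ∣ W⁻¹ q S ∣ + 0            ≡⟨ cong (∣ W⁻¹ q S ∣ +_) (sym (∉⇒χ≡0 q∉S)) ⟩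
    ∣ W⁻¹ q S ∣ + χ S q        ≡⟨ ∣⁻¹∣ _ q (σ q) (image-W q) (fibre-W q) S ⟩
    ∣ S ∣ + χ S (σ q)          ≡⟨ cong (∣ S ∣ +_) (∈⇒χ≡1 σq∈S) ⟩
    ∣ S ∣ + 1                  ∎
    where open ≡-Reasoning

  reach-step : ∀ {q S} u → q ∉ S → ReachableBy A (W⁻¹ q S) u → ReachableBy A S (u ++ W q)
  reach-step {q} {S} u q∉S = reach-++ A u (W q) S
    (λ x x∈S → image-W q x (λ x≡q → q∉S (subst (_∈ S) x≡q x∈S)))

  reach-by-W : ∀ d (S : Subset n) → ∣ S ∣ + d ≡ n → 1 ≤ ∣ S ∣ →
    ∃ λ (is : Vec (Fin n) d) → ReachableBy A S (concatMap W (toList is))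
  reach-by-W zero S ∣S∣+0≡n _ =
    [] , reach-all A S (∣∣≡n⇒∈ S (trans (sym (+-identityʳ ∣ S ∣)) ∣S∣+0≡n))
  reach-by-W (suc d) S ∣S∣+d+1≡n 1≤∣S∣
    with ∣∣<n⇒∉ S (subst (∣ S ∣ <_) ∣S∣+d+1≡n (m<m+n ∣ S ∣ (0<1+n {d})))
       | 1≤∣∣⇒nonempty S 1≤∣S∣
  ... | r , r∉S | s , s∈S with exit-point σ cyclic S r∉S s∈S
  ... | q , q∉S , σq∈S with ∣W⁻¹∣ q S q∉S σq∈S
  ... | ∣T∣≡∣S∣+1 with reach-by-W d (W⁻¹ q S)
                         (trans (cong (_+ d) ∣T∣≡∣S∣+1) (trans (+-assoc ∣ S ∣ 1 d) ∣S∣+d+1≡n))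
                         (subst (1 ≤_) (sym ∣T∣≡∣S∣+1) (m≤n+m 1 ∣ S ∣))
  ... | is , reach-T = is ∷ʳ q , subst (ReachableBy A S) (sym (concatMap-∷ʳ W is q))
                                   (reach-step (concatMap W (toList is)) q∉S reach-T)

theorem1 : (n m : ℕ) (A : DFA n m) (W : Fin n → Word m) (σ : Fin n → Fin n) →
    IsOneContractingCollection A W → IsInducedStateMap A W σ → IsCyclic σ →
    (k : ℕ) → 1 ≤ k → k ≤ n → (S : Subset n) → ∣ S ∣ ≡ k →
    ∃ λ (is : Vec (Fin n) (n ∸ k)) → ReachableBy A S (concatMap W (toList is))
theorem1 n m A W σ contracting induced cyclic k 1≤k k≤n S ∣S∣≡k =
  reach-by-W A W σ contracting induced cyclic (n ∸ k) S
    (trans (cong (_+ (n ∸ k)) ∣S∣≡k) (m+[n∸m]≡n k≤n))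
    (subst (1 ≤_) (sym ∣S∣≡k) 1≤k)
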